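{- For every $n\geq 1$, $\operatorname{sg}(S_n,2)=0$.
   Context: PAP with pattern length $k$: a position is a subset $X\subseteq S_n$ ($S_n$ = permutations of $\{1,\ldots,n\}$); a move chooses a pattern $p\in S_k$ contained (classically) in at least one permutation of $X$ and replaces $X$ by the permutations of $X$ avoiding $p$; normal play. The Sprague--Grundy value is $\operatorname{sg}(X)=\operatorname{mex}\{\operatorname{sg}(Y): Y\text{ reachable from }X\text{ in one move}\}$ (terminal positions have value $0$), and $\operatorname{sg}(S_n,k)$ is the value of the starting position $S_n$ in PAP with pattern length $k$. -}

module Defs where

open import Data.Nat using (ℕ; zero; suc; _≡ᵇ_; _<ᵇ_)
open import Data.Bool using (Bool; true; false; _∧_; not; if_then_else_)
open import Data.Bool.Properties using () renaming (_≟_ to _≟B_)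
open import Data.List using (List; []; _∷_; [_]; _++_; map; concatMap; filterᵇ; length)
open import Data.Bool.ListAction using (all; any)

-- A permutation of {1,…,n} is represented in one-line notation as the list
-- [σ(1), …, σ(n)] of natural numbers.
Perm : Set
Perm = List ℕ

Position : Set
Position = List Perm

oneTo : ℕ → List ℕ
oneTo zero    = []
oneTo (suc n) = oneTo n ++ [ suc n ]

elemᵇ : ℕ → List ℕ → Bool
elemᵇ x = any (λ y → x ≡ᵇ y)

allLists : ℕ → ℕ → List (List ℕ)
allLists n zero      = [ [] ]
allLists n (suc len) = concatMap (λ x → map (x ∷_) (allLists n len)) (oneTo n)

-- a length-n list over {1..n} containing every value 1..n is a permutation
isPermᵇ : ℕ → List ℕ → Bool
isPermᵇ n l = (length l ≡ᵇ n) ∧ all (λ i → elemᵇ i l) (oneTo n)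

S : ℕ → Position
S n = filterᵇ (isPermᵇ n) (allLists n n)

subseqs : {A : Set} → List A → List (List A)
subseqs []       = [ [] ]
subseqs (x ∷ xs) = map (x ∷_) (subseqs xs) ++ subseqs xs

boolEq : Bool → Bool → Bool
boolEq true  b = b
boolEq false b = not b

sameCmp : ℕ → ℕ → List ℕ → List ℕ → Bool
sameCmp a b []        []        = true
sameCmp a b (x ∷ xs) (y ∷ ys) = boolEq (a <ᵇ x) (b <ᵇ y) ∧ boolEq (x <ᵇ a) (y <ᵇ b) ∧ sameCmp a b xs ys
sameCmp a b _         _         = false

orderIsoᵇ : List ℕ → List ℕ → Bool
orderIsoᵇ []       []       = true
orderIsoᵇ (a ∷ as) (b ∷ bs) = sameCmp a b as bs ∧ orderIsoᵇ as bs
orderIsoᵇ _        _        = false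

containsᵇ : Perm → Perm → Bool
containsᵇ σ p = any (λ s → orderIsoᵇ s p) (subseqs σ)

mexGo : ℕ → ℕ → List ℕ → ℕ
mexGo zero     m xs = m
mexGo (suc f) m xs = if elemᵇ m xs then mexGo f (suc m) xs else m

mex : List ℕ → ℕ
mex xs = mexGo (suc (length xs)) 0 xs

moves : ℕ → Position → List Perm
moves k X = filterᵇ (λ p → any (λ σ → containsᵇ σ p) X) (S k)

play : Perm → Position → Position
play p X = filterᵇ (λ σ → not (containsᵇ σ p)) X

sgFuel : ℕ → ℕ → Position → ℕ
sgFuel k zero     X = 0
sgFuel k (suc f) X = mex (map (λ p → sgFuel k f (play p X)) (moves k X))

-- Each move removes at least one permutation from X, so fuel |X|+1 suffices
-- and sg k X is the genuine Sprague–Grundy value of X in PAP with pattern length k.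
sg : ℕ → Position → ℕ
sg k X = sgFuel k (suc (length X)) X

-- For n = 1 no pattern of length 2 occurs, so there is no move.  For n ≥ 2 the values 1 and 2
-- occur in every permutation, so each permutation contains 12 or 21.  Hence after either opening
-- move (say 12) every remaining permutation contains the other pattern (21), and some permutation
-- remains (the decreasing one).  The reply 21 then empties the position, so both options of S_n
-- have non-zero value and S_n itself has value 0.
module Submission where

open import Defs
open import Data.Nat using (ℕ; _≥_; zero; suc; _<_; _>_; _≤_; z<s; s<s; _≡ᵇ_; _<ᵇ_)
open import Data.Nat.Properties
  using (≡ᵇ⇒≡; ≡⇒≡ᵇ; <ᵇ-reflects-<; <-asym; ≤-refl; ≤-trans; n≤1+n; m<n⇒n≢0)
open import Data.Bool using (true; false; not; T)
open import Data.Bool.Properties using (T-∧)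
open import Data.Empty using (⊥-elim)
open import Data.Product using (∃; ∃₂; _×_; _,_; proj₁; proj₂)
import Data.Product as Product
open import Data.Sum using (_⊎_; inj₁; inj₂; swap)
import Data.Sum as Sum
open import Data.List using (List; []; _∷_; [_]; _∷ʳ_; map; length; applyUpTo; applyDownFrom)
open import Data.List.Properties
  using (applyUpTo-∷ʳ; length-applyUpTo; length-applyDownFrom; filter-none)
open import Data.List.Membership.Propositional using (_∈_; find; lose)
open import Data.List.Membership.Propositional.Properties
  using (∈-map⁺; ∈-map⁻; ∈-++⁺ˡ; ∈-++⁺ʳ; ∈-++⁻; ∈-concatMap⁺; ∈-filter⁺; ∈-filter⁻;
         ∈-applyUpTo⁺; ∈-applyUpTo⁻; ∈-applyDownFrom⁺; ∈-applyDownFrom⁻; ∈-length)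
open import Data.List.Relation.Unary.Any as Any using (Any; here; there)
open import Data.List.Relation.Unary.Any.Properties using (any⁺; any⁻; ¬Any[])
open import Data.List.Relation.Unary.All as All using (All; []; _∷_)
open import Data.List.Relation.Unary.All.Properties using (all⁺; all⁻)
open import Data.List.Relation.Unary.AllPairs using (AllPairs; []; _∷_)
import Data.List.Relation.Unary.AllPairs.Properties as AllPairs
open import Function using (_∘_; id; Equivalence)
open import Relation.Binary.PropositionalEquality
  using (_≡_; _≢_; refl; sym; trans; cong; subst; module ≡-Reasoning)
open import Relation.Nullary using (¬_; ofʸ)
open import Relation.Nullary.Decidable using (T?)

private variable
  A : Set
  x y : A
  s xs : List A
  n : ℕ
  p q σ : Perm
  X : Position

¬T⇒T-not : ∀ {b} → ¬ T b → T (not b)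
¬T⇒T-not {false} _  = _
¬T⇒T-not {true}  ¬t = ¬t _

T-not⇒¬T : ∀ {b} → T (not b) → ¬ T b
T-not⇒¬T {false} _ ()

∈⇒elemᵇ : x ∈ xs → T (elemᵇ x xs)
∈⇒elemᵇ {x = x} = any⁺ (x ≡ᵇ_) ∘ Any.map (≡⇒≡ᵇ x _)

elemᵇ⇒∈ : ∀ xs → T (elemᵇ x xs) → x ∈ xs
elemᵇ⇒∈ {x = x} xs = Any.map (≡ᵇ⇒≡ x _) ∘ any⁻ (x ≡ᵇ_) xs

mexGo-≥ : ∀ fuel m xs → m ≤ mexGo fuel m xs
mexGo-≥ zero       m xs = ≤-refl
mexGo-≥ (suc fuel) m xs with elemᵇ m xs
... | true  = ≤-trans (n≤1+n m) (mexGo-≥ fuel (suc m) xs)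
... | false = ≤-refl

mex≡0 : ∀ xs → ¬ T (elemᵇ 0 xs) → mex xs ≡ 0
mex≡0 xs 0∉xs with elemᵇ 0 xs
... | false = refl
... | true  = ⊥-elim (0∉xs _)

mex≢0 : ∀ xs → T (elemᵇ 0 xs) → mex xs ≢ 0
mex≢0 xs 0∈xs with elemᵇ 0 xs
... | true = m<n⇒n≢0 (mexGo-≥ (length xs) 1 xs)

∈-moves⁺ : ∀ k → p ∈ S k → σ ∈ X → T (containsᵇ σ p) → p ∈ moves k X
∈-moves⁺ _ p∈S σ∈X σ⊇p = ∈-filter⁺ (T? ∘ _) p∈S (any⁺ _ (lose σ∈X σ⊇p))

∈-moves⁻ : ∀ k X → p ∈ moves k X → p ∈ S k × Any (λ σ → T (containsᵇ σ p)) X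
∈-moves⁻ _ X p∈ = Product.map₂ (any⁻ _ X) (∈-filter⁻ (T? ∘ _) p∈)

∈-play⁺ : σ ∈ X → ¬ T (containsᵇ σ p) → σ ∈ play p X
∈-play⁺ σ∈X σ⊉p = ∈-filter⁺ (T? ∘ _) σ∈X (¬T⇒T-not σ⊉p)

∈-play⁻ : σ ∈ play p X → σ ∈ X × ¬ T (containsᵇ σ p)
∈-play⁻ σ∈ = Product.map₂ T-not⇒¬T (∈-filter⁻ (T? ∘ _) σ∈)

play-≡[] : (∀ {σ} → σ ∈ X → T (containsᵇ σ p)) → play p X ≡ []
play-≡[] ⊇p = filter-none (T? ∘ _) (All.tabulate (λ σ∈X σ⊉p → T-not⇒¬T σ⊉p (⊇p σ∈X)))

optionValues : ℕ → ℕ → Position → List ℕ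
optionValues k f X = map (λ p → sgFuel k f (play p X)) (moves k X)

sgFuel-≡0 : ∀ k f X → (∀ {p} → p ∈ moves k X → sgFuel k f (play p X) ≢ 0) →
            sgFuel k (suc f) X ≡ 0
sgFuel-≡0 k f X options≢0 = mex≡0 (optionValues k f X) λ 0∈ →
  let _ , p∈ , 0≡option = ∈-map⁻ _ (elemᵇ⇒∈ _ 0∈) in options≢0 p∈ (sym 0≡option)

sgFuel-≢0 : ∀ k f X → p ∈ moves k X → sgFuel k f (play p X) ≡ 0 → sgFuel k (suc f) X ≢ 0
sgFuel-≢0 k f X p∈ option≡0 =
  mex≢0 (optionValues k f X) (∈⇒elemᵇ (subst (_∈ optionValues k f X) option≡0 (∈-map⁺ _ p∈)))

sgFuel-[] : ∀ k f → sgFuel k f [] ≡ 0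
sgFuel-[] k zero    = refl
sgFuel-[] k (suc f) = sgFuel-≡0 k f [] λ p∈ → ⊥-elim (¬Any[] (proj₂ (∈-moves⁻ k [] p∈)))

common-pattern⇒sgFuel≢0 : ∀ k f X → p ∈ S k → σ ∈ X → (∀ {τ} → τ ∈ X → T (containsᵇ τ p)) →
                          sgFuel k (suc f) X ≢ 0
common-pattern⇒sgFuel≢0 k f X p∈S σ∈X ⊇p = sgFuel-≢0 k f X (∈-moves⁺ k p∈S σ∈X (⊇p σ∈X)) (begin
  sgFuel k f (play _ X) ≡⟨ cong (sgFuel k f) (play-≡[] ⊇p) ⟩
  sgFuel k f []         ≡⟨ sgFuel-[] k f ⟩
  0                     ∎)
  where open ≡-Reasoning

contains-p-or-q⇒sgFuel-play≢0 : ∀ k f X → q ∈ S k → σ ∈ X → ¬ T (containsᵇ σ p) →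
                                (∀ {τ} → τ ∈ X → T (containsᵇ τ p) ⊎ T (containsᵇ τ q)) →
                                sgFuel k (suc f) (play p X) ≢ 0
contains-p-or-q⇒sgFuel-play≢0 k f X q∈S σ∈X σ⊉p ⊇p-or-q =
  common-pattern⇒sgFuel≢0 k f _ q∈S (∈-play⁺ σ∈X σ⊉p) λ τ∈ →
    let τ∈X , τ⊉p = ∈-play⁻ τ∈ in Sum.fromInj₂ (⊥-elim ∘ τ⊉p) (⊇p-or-q τ∈X)

[]∈subseqs : ∀ (xs : List A) → [] ∈ subseqs xs
[]∈subseqs []       = here refl
[]∈subseqs (x ∷ xs) = ∈-++⁺ʳ (map (x ∷_) (subseqs xs)) ([]∈subseqs xs)

∷∈subseqs⁺ : s ∈ subseqs xs → x ∷ s ∈ subseqs (x ∷ xs)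
∷∈subseqs⁺ {x = x} s∈ = ∈-++⁺ˡ (∈-map⁺ (x ∷_) s∈)

∈subseqs-∷ : s ∈ subseqs xs → s ∈ subseqs (x ∷ xs)
∈subseqs-∷ {xs = xs} {x = x} s∈ = ∈-++⁺ʳ (map (x ∷_) (subseqs xs)) s∈

[x]∈subseqs : x ∈ xs → [ x ] ∈ subseqs xs
[x]∈subseqs {xs = _ ∷ xs} (here refl) = ∷∈subseqs⁺ {xs = xs} ([]∈subseqs xs)
[x]∈subseqs {xs = _ ∷ xs} (there x∈)  = ∈subseqs-∷ {xs = xs} ([x]∈subseqs x∈)

pair∈subseqs : x ≢ y → x ∈ xs → y ∈ xs → x ∷ y ∷ [] ∈ subseqs xs ⊎ y ∷ x ∷ [] ∈ subseqs xs
pair∈subseqs x≢y (here refl) (here refl) = ⊥-elim (x≢y refl)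
pair∈subseqs {xs = _ ∷ xs} x≢y (here refl) (there y∈) = inj₁ (∷∈subseqs⁺ {xs = xs} ([x]∈subseqs y∈))
pair∈subseqs {xs = _ ∷ xs} x≢y (there x∈) (here refl) = inj₂ (∷∈subseqs⁺ {xs = xs} ([x]∈subseqs x∈))
pair∈subseqs {xs = _ ∷ xs} x≢y (there x∈) (there y∈)  =
  Sum.map (∈subseqs-∷ {xs = xs}) (∈subseqs-∷ {xs = xs}) (pair∈subseqs x≢y x∈ y∈)

All-subseqs : ∀ {P : A → Set} → All P xs → s ∈ subseqs xs → All P s
All-subseqs {xs = []}     []         (here refl) = []
All-subseqs {xs = x ∷ xs} (px ∷ pxs) s∈ with ∈-++⁻ (map (x ∷_) (subseqs xs)) s∈
... | inj₁ s∈map with _ , t∈ , refl ← ∈-map⁻ (x ∷_) s∈map = px ∷ All-subseqs pxs t∈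
... | inj₂ s∈tail = All-subseqs pxs s∈tail

AllPairs-subseqs : ∀ {R : A → A → Set} → AllPairs R xs → s ∈ subseqs xs → AllPairs R s
AllPairs-subseqs {xs = []}     []           (here refl) = []
AllPairs-subseqs {xs = x ∷ xs} (rx ∷ rxs) s∈ with ∈-++⁻ (map (x ∷_) (subseqs xs)) s∈
... | inj₁ s∈map with _ , t∈ , refl ← ∈-map⁻ (x ∷_) s∈map =
  All-subseqs rx t∈ ∷ AllPairs-subseqs rxs t∈
... | inj₂ s∈tail = AllPairs-subseqs rxs s∈tail

p12 p21 : Perm
p12 = 1 ∷ 2 ∷ []
p21 = 2 ∷ 1 ∷ []

containsᵇ⁺ : s ∈ subseqs σ → T (orderIsoᵇ s p) → T (containsᵇ σ p)
containsᵇ⁺ s∈ s≅p = any⁺ _ (lose s∈ s≅p)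

orderIsoᵇ-length : ∀ s p → T (orderIsoᵇ s p) → length s ≡ length p
orderIsoᵇ-length []       []       _   = refl
orderIsoᵇ-length (a ∷ as) (b ∷ bs) s≅p =
  cong suc (orderIsoᵇ-length as bs (proj₂ (Equivalence.to T-∧ s≅p)))

length≡2⇒pair : ∀ (s : List A) → length s ≡ 2 → ∃₂ λ a b → s ≡ a ∷ b ∷ []
length≡2⇒pair (a ∷ b ∷ []) refl = a , b , refl

containsᵇ-pair⁻ : ∀ σ → T (containsᵇ σ (x ∷ y ∷ [])) →
                  ∃₂ λ a b → a ∷ b ∷ [] ∈ subseqs σ × T (orderIsoᵇ (a ∷ b ∷ []) (x ∷ y ∷ []))
containsᵇ-pair⁻ σ σ⊇p with s , s∈ , s≅p ← find (any⁻ _ (subseqs σ) σ⊇p)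
  with a , b , refl ← length≡2⇒pair s (orderIsoᵇ-length s _ s≅p)
  = a , b , s∈ , s≅p

orderIsoᵇ-12⇒< : ∀ a b → T (orderIsoᵇ (a ∷ b ∷ []) p12) → a < b
orderIsoᵇ-12⇒< a b ab≅12 with a <ᵇ b | <ᵇ-reflects-< a b
... | true | ofʸ a<b = a<b

orderIsoᵇ-21⇒> : ∀ a b → T (orderIsoᵇ (a ∷ b ∷ []) p21) → a > b
orderIsoᵇ-21⇒> a b ab≅21 with a <ᵇ b | b <ᵇ a | <ᵇ-reflects-< b a
... | _     | true  | ofʸ b<a = b<a
... | true  | false | _       = ⊥-elim ab≅21
... | false | false | _       = ⊥-elim ab≅21

ascending⇒¬contains-21 : AllPairs _<_ σ → ¬ T (containsᵇ σ p21)
ascending⇒¬contains-21 {σ} asc σ⊇21 with a , b , ab∈ , ab≅21 ← containsᵇ-pair⁻ σ σ⊇21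
  with (a<b ∷ []) ∷ _ ← AllPairs-subseqs asc ab∈
  = <-asym a<b (orderIsoᵇ-21⇒> a b ab≅21)

descending⇒¬contains-12 : AllPairs _>_ σ → ¬ T (containsᵇ σ p12)
descending⇒¬contains-12 {σ} desc σ⊇12 with a , b , ab∈ , ab≅12 ← containsᵇ-pair⁻ σ σ⊇12
  with (a>b ∷ []) ∷ _ ← AllPairs-subseqs desc ab∈
  = <-asym a>b (orderIsoᵇ-12⇒< a b ab≅12)

contains-12-or-21 : 1 ∈ σ → 2 ∈ σ → T (containsᵇ σ p12) ⊎ T (containsᵇ σ p21)
contains-12-or-21 {σ} 1∈ 2∈ =
  Sum.map (λ 12∈ → containsᵇ⁺ {σ = σ} 12∈ _) (λ 21∈ → containsᵇ⁺ {σ = σ} 21∈ _)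
          (pair∈subseqs (λ ()) 1∈ 2∈)

oneTo≡applyUpTo : ∀ n → oneTo n ≡ applyUpTo suc n
oneTo≡applyUpTo zero    = refl
oneTo≡applyUpTo (suc n) = trans (cong (_∷ʳ suc n) (oneTo≡applyUpTo n)) (applyUpTo-∷ʳ suc n)

∈-oneTo⁺ : ∀ {i} → i < n → suc i ∈ oneTo n
∈-oneTo⁺ {n} i<n = subst (_ ∈_) (sym (oneTo≡applyUpTo n)) (∈-applyUpTo⁺ suc i<n)

∈-oneTo⁻ : ∀ {v} → v ∈ oneTo n → ∃ λ i → i < n × v ≡ suc i
∈-oneTo⁻ {n} v∈ = ∈-applyUpTo⁻ suc (subst (_ ∈_) (oneTo≡applyUpTo n) v∈)

allLists-complete : ∀ n (l : List ℕ) → All (_∈ oneTo n) l → l ∈ allLists n (length l)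
allLists-complete n []      []         = here refl
allLists-complete n (x ∷ l) (x∈ ∷ l∈) =
  ∈-concatMap⁺ _ (lose x∈ (∈-map⁺ (x ∷_) (allLists-complete n l l∈)))

∈-S⁺ : length σ ≡ n → All (_∈ oneTo n) σ → All (_∈ σ) (oneTo n) → σ ∈ S n
∈-S⁺ {σ} refl values onto =
  ∈-filter⁺ (T? ∘ isPermᵇ (length σ)) (allLists-complete (length σ) σ values)
    (Equivalence.from T-∧ (≡⇒≡ᵇ (length σ) _ refl , all⁻ (λ i → elemᵇ i σ) (All.map ∈⇒elemᵇ onto)))

∈-S⁻ : σ ∈ S n → All (_∈ σ) (oneTo n)
∈-S⁻ {σ} {n} σ∈S = All.map (elemᵇ⇒∈ σ) (all⁺ _ (oneTo n) (proj₂ (Equivalence.to T-∧ isPerm)))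
  where isPerm = proj₂ (∈-filter⁻ (T? ∘ isPermᵇ n) {xs = allLists n n} σ∈S)

S-contains-12-or-21 : ∀ m → σ ∈ S (suc (suc m)) → T (containsᵇ σ p12) ⊎ T (containsᵇ σ p21)
S-contains-12-or-21 m σ∈S =
  contains-12-or-21 (All.lookup onto (∈-oneTo⁺ z<s)) (All.lookup onto (∈-oneTo⁺ (s<s z<s)))
  where onto = ∈-S⁻ {n = suc (suc m)} σ∈S

oneTo-ascending : ∀ n → AllPairs _<_ (oneTo n)
oneTo-ascending n =
  subst (AllPairs _<_) (sym (oneTo≡applyUpTo n)) (AllPairs.applyUpTo⁺₁ suc n λ i<j _ → s<s i<j)

applyDownFrom-descending : ∀ n → AllPairs _>_ (applyDownFrom suc n)
applyDownFrom-descending n = AllPairs.applyDownFrom⁺₁ suc n λ j<i _ → s<s j<i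

oneTo∈S : ∀ n → oneTo n ∈ S n
oneTo∈S n = ∈-S⁺ length≡n (All.tabulate id) (All.tabulate id)
  where length≡n = trans (cong length (oneTo≡applyUpTo n)) (length-applyUpTo suc n)

applyDownFrom∈S : ∀ n → applyDownFrom suc n ∈ S n
applyDownFrom∈S n = ∈-S⁺ (length-applyDownFrom suc n) (All.tabulate values) (All.tabulate onto)
  where
  values : ∀ {v} → v ∈ applyDownFrom suc n → v ∈ oneTo n
  values v∈ with _ , i<n , refl ← ∈-applyDownFrom⁻ suc v∈ = ∈-oneTo⁺ i<n
  onto : ∀ {v} → v ∈ oneTo n → v ∈ applyDownFrom suc n
  onto v∈ with _ , i<n , refl ← ∈-oneTo⁻ {n} v∈ = ∈-applyDownFrom⁺ suc i<n

proposition2p3 : (n : ℕ) → n ≥ 1 → sg 2 (S n) ≡ 0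
proposition2p3 (suc zero)        _ = refl
proposition2p3 n@(suc (suc m)) _ = sgFuel-≡0 2 (length (S n)) (S n) option≢0
  where
  option≢0 : ∀ {p} → p ∈ moves 2 (S n) → sgFuel 2 (length (S n)) (play p (S n)) ≢ 0
  option≢0 p∈ with length (S n) | ∈-length (oneTo∈S n) | proj₁ (∈-moves⁻ 2 (S n) p∈)
  ... | suc f | _ | here refl =
    contains-p-or-q⇒sgFuel-play≢0 2 f (S n) (there (here refl)) (applyDownFrom∈S n)
      (descending⇒¬contains-12 (applyDownFrom-descending n)) (S-contains-12-or-21 m)
  ... | suc f | _ | there (here refl) =
    contains-p-or-q⇒sgFuel-play≢0 2 f (S n) (here refl) (oneTo∈S n)
      (ascending⇒¬contains-21 (oneTo-ascending n)) (swap ∘ S-contains-12-or-21 m)
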